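{- Let $(a_n)_{n\ge 0}$ be a sequence of real numbers with $a_0=1$, let $F(t)=1+\sum_{n\ge1}a_n\frac{t^n}{n!}$, and for every real $\alpha$ define polynomials $f_n^{(\alpha)}(x)$ by $\sum_{n\ge0}f_n^{(\alpha)}(x)\frac{t^n}{n!}=(F(t))^{\alpha}e^{xt}$. Let $n$ be a non-negative integer, let $(u_k)$, $(v_k)$ be sequences of real numbers, and let $U(n,k)$, $V(n,k)$ ($0\le k\le n$) be real numbers such that $$\sum_{k=0}^{n}U(n,k)(x+u_k)^k=\sum_{k=0}^{n}V(n,k)(x+v_k)^k\quad\text{for all real }x.$$ Then for every real $\alpha$ and every real $x$, $$\sum_{k=0}^{n}U(n,k)f_k^{(\alpha)}(x+u_k)=\sum_{k=0}^{n}V(n,k)f_k^{(\alpha)}(x+v_k),$$ and $$\sum_{k=0}^{n}U(n,k)\Big(f_{k+1}^{(\alpha)}(x+u_k)-u_kf_k^{(\alpha)}(x+u_k)\Big)=\sum_{k=0}^{n}V(n,k)\Big(f_{k+1}^{(\alpha)}(x+v_k)-v_kf_k^{(\alpha)}(x+v_k)\Big).$$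
   Context: Here $(F(t))^\alpha=\exp(\alpha\log F(t))$ as a formal power series (well defined since $F(0)=1$). -}

module Defs where

open import Level using (0ℓ)
open import Algebra.Bundles using (CommutativeRing)
open import Data.Nat using (ℕ; zero; suc; _∸_)
open import Data.Nat.Base using (_!)
open import Data.Product using (Σ; ∃; _×_; _,_)
open import Data.Sum using (_⊎_)
open import Relation.Nullary using (¬_)
open import Relation.Binary.Structures using (IsStrictTotalOrder)

-- An axiomatisation of the real numbers: a complete ordered field.
-- (Any two models are isomorphic, so quantifying over all models is the
-- same as speaking about ℝ.)  The multiplicative inverse is made total
-- (the value of 0⁻¹ is unspecified); it is only ever applied to nonzero
-- elements below.
record RealField : Set₁ where
  field
    commutativeRing : CommutativeRing 0ℓ 0ℓ
  open CommutativeRing commutativeRing public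
    using (Carrier; _≈_; _+_; _*_; -_; _-_; 0#; 1#)
  infix 4 _<_ _≤_
  field
    _<_ : Carrier → Carrier → Set
    <-isStrictTotalOrder : IsStrictTotalOrder _≈_ _<_
  _≤_ : Carrier → Carrier → Set
  x ≤ y = x < y ⊎ x ≈ y
  infix 8 _⁻¹
  field
    _⁻¹ : Carrier → Carrier
    ⁻¹-cong : ∀ {x y} → x ≈ y → x ⁻¹ ≈ y ⁻¹
    0≉1 : ¬ (0# ≈ 1#)
    inverseʳ : ∀ x → ¬ (x ≈ 0#) → x * (x ⁻¹) ≈ 1#
    +-monoˡ-< : ∀ {x y} z → x < y → x + z < y + z
    *-pos : ∀ {x y} → 0# < x → 0# < y → 0# < x * y
    complete : (P : Carrier → Set) → ∃ P → (∃ λ b → ∀ x → P x → x ≤ b) →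
               ∃ λ s → (∀ x → P x → x ≤ s) × (∀ b → (∀ x → P x → x ≤ b) → s ≤ b)

module RF (ℝ : RealField) where
  open RealField ℝ public
    using (Carrier; _≈_; _+_; _*_; -_; _-_; 0#; 1#; _⁻¹; _<_; _≤_)

  fromℕ : ℕ → Carrier
  fromℕ zero = 0#
  fromℕ (suc n) = 1# + fromℕ n

  pow : Carrier → ℕ → Carrier
  pow x zero = 1#
  pow x (suc k) = x * pow x k

  sumTo : ℕ → (ℕ → Carrier) → Carrier
  sumTo zero g = g zero
  sumTo (suc n) g = sumTo n g + g (suc n)

  -- formal power series over ℝ, by ordinary coefficients: s n = [tⁿ] s
  Series : Set
  Series = ℕ → Carrier

  oneS : Series
  oneS zero = 1#
  oneS (suc n) = 0#

  _⊛_ : Series → Series → Series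
  (f ⊛ g) n = sumTo n (λ j → f j * g (n ∸ j))

  powS : Series → ℕ → Series
  powS f zero = oneS
  powS f (suc m) = f ⊛ powS f m

  -- exp(L) = Σ_{m≥0} L^m / m!   (for L with L 0 = 0; only m ≤ n contribute to tⁿ)
  expS : Series → Series
  expS L n = sumTo n (λ m → powS L m n * (fromℕ (m !)) ⁻¹)

  -- log(G) = Σ_{m≥1} (-1)^{m+1} (G - 1)^m / m   (for G with G 0 = 1)
  logS : Series → Series
  logS G n = sumTo n term
    where
    G-1 : Series
    G-1 zero = 0#
    G-1 (suc k) = G (suc k)
    term : ℕ → Carrier
    term zero = 0#
    term (suc m) = pow (- 1#) m * powS G-1 (suc m) n * (fromℕ (suc m)) ⁻¹

  powαS : Series → Carrier → Series
  powαS G α = expS (λ n → α * logS G n)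

  Fser : (ℕ → Carrier) → Series
  Fser a zero = 1#
  Fser a (suc n) = a (suc n) * (fromℕ (suc n !)) ⁻¹

  expX : Carrier → Series
  expX x n = pow x n * (fromℕ (n !)) ⁻¹

  fpoly : (ℕ → Carrier) → Carrier → ℕ → Carrier → Carrier
  fpoly a α n x = fromℕ (n !) * ((powαS (Fser a) α ⊛ expX x) n)

-- For every formal power series G, the polynomials fₘ(y) = m! [tᵐ] G(t) e^{yt} are
-- Σⱼ Gⱼ (dʲ/dyʲ) yᵐ: one linear differential operator L = Σⱼ Gⱼ Dʲ, commuting with
-- translations, turns every shifted power (y + w)ᵐ into fₘ(y + w).  So L applied to a linear
-- combination Σ c (y + w)ᵐ depends only on the function the combination defines: its
-- derivatives at x are, up to factorials, the coefficients of its expansion in powers of h at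
-- x + h, and these are unique because the field is infinite.  The first identity is this for
-- Σₖ U(n,k) (y + uₖ)ᵏ, the second for y times it, that is Σₖ U(n,k) ((y + uₖ)ᵏ⁺¹ − uₖ (y + uₖ)ᵏ).
module Submission where

open import Defs
open import Algebra.Bundles using (CommutativeRing)
open import Data.Empty using (⊥-elim)
open import Data.List using (List; []; _∷_; _++_; foldr; applyUpTo)
open import Data.List.Relation.Unary.All as All using (All; []; _∷_)
open import Data.Nat as ℕ using (ℕ; zero; suc; _∸_; _!; _⊔_; z≤n; s≤s)
import Data.Nat.Properties as ℕ
open import Data.Product using (_×_; _,_; ∃)
open import Data.Sum using (inj₁; inj₂)
open import Function using (_∘_)
open import Relation.Binary.Definitions using (tri<; tri≈; tri>)
open import Relation.Binary.Structures using (IsStrictTotalOrder)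
open import Relation.Binary.PropositionalEquality as ≡ using (_≡_)

module Appell (ℝ : RealField) where
  open RealField ℝ using (commutativeRing; _<_; <-isStrictTotalOrder; _⁻¹; 0≉1; inverseʳ; +-monoˡ-<; *-pos)
  open CommutativeRing commutativeRing
  open RF ℝ using (fromℕ; pow; sumTo; Series; _⊛_; expX)
  open IsStrictTotalOrder <-isStrictTotalOrder
    using (compare; irrefl; <-respʳ-≈; <-respˡ-≈) renaming (trans to <-trans)
  open import Relation.Binary.Reasoning.Setoid setoid
  open import Algebra.Properties.Ring ring using (-‿involutive; -1*x≈-x; -‿distribˡ-*; -‿distribʳ-*)
  open import Algebra.Properties.Group +-group using ()
    renaming (x∙y⁻¹≈ε⇒x≈y to x-y≈0⇒x≈y; x≈y⇒x∙y⁻¹≈ε to x≈y⇒x-y≈0; //-rightDividesʳ to x+y-y≈x)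
  open import Algebra.Properties.CommutativeSemigroup +-commutativeSemigroup using ()
    renaming (interchange to +-interchange)
  open import Algebra.Properties.CommutativeSemigroup *-commutativeSemigroup using (x∙yz≈y∙xz; x∙yz≈xy∙z)
  open import Algebra.Solver.Ring.NaturalCoefficients.Default commutativeSemiring using (solve; _:=_; _:+_; _:*_)

  fromℕ-+ : ∀ m n → fromℕ (m ℕ.+ n) ≈ fromℕ m + fromℕ n
  fromℕ-+ zero n = sym (+-identityˡ _)
  fromℕ-+ (suc m) n = trans (+-congˡ (fromℕ-+ m n)) (sym (+-assoc _ _ _))

  fromℕ-* : ∀ m n → fromℕ (m ℕ.* n) ≈ fromℕ m * fromℕ n
  fromℕ-* zero n = sym (zeroˡ _)
  fromℕ-* (suc m) n = begin
    fromℕ (n ℕ.+ m ℕ.* n)             ≈⟨ fromℕ-+ n (m ℕ.* n) ⟩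
    fromℕ n + fromℕ (m ℕ.* n)         ≈⟨ +-cong (sym (*-identityˡ _)) (fromℕ-* m n) ⟩
    1# * fromℕ n + fromℕ m * fromℕ n  ≈⟨ distribʳ _ _ _ ⟨
    (1# + fromℕ m) * fromℕ n          ∎

  fromℕ-+-∸ : ∀ {j n} → j ℕ.≤ n → fromℕ n ≈ fromℕ j + fromℕ (n ∸ j)
  fromℕ-+-∸ {j} {n} j≤n = trans (reflexive (≡.cong fromℕ (≡.sym (ℕ.m+[n∸m]≡n j≤n)))) (fromℕ-+ j (n ∸ j))

  fromℕ-n∸n : ∀ n → fromℕ (n ∸ n) ≈ 0#
  fromℕ-n∸n zero = refl
  fromℕ-n∸n (suc n) = fromℕ-n∸n n

  0<1 : 0# < 1#
  0<1 with compare 0# 1#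
  ... | tri< lt _ _ = lt
  ... | tri≈ _ 0≈1 _ = ⊥-elim (0≉1 0≈1)
  ... | tri> _ _ 1<0 = <-respʳ-≈ -1*-1≈1 (*-pos 0<-1 0<-1)
    where
    0<-1 : 0# < - 1#
    0<-1 = <-respˡ-≈ (-‿inverseʳ 1#) (<-respʳ-≈ (+-identityˡ _) (+-monoˡ-< (- 1#) 1<0))
    -1*-1≈1 : - 1# * - 1# ≈ 1#
    -1*-1≈1 = trans (-1*x≈-x (- 1#)) (-‿involutive 1#)

  x<x+1 : ∀ x → x < x + 1#
  x<x+1 x = <-respʳ-≈ (+-comm _ _) (<-respˡ-≈ (+-identityˡ x) (+-monoˡ-< x 0<1))

  0<fromℕ-suc : ∀ n → 0# < fromℕ (suc n)
  0<fromℕ-suc zero = <-respʳ-≈ (sym (+-identityʳ _)) 0<1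
  0<fromℕ-suc (suc n) =
    <-respʳ-≈ (+-comm _ _) (<-trans (<-respʳ-≈ (sym (+-identityˡ _)) 0<1) (+-monoˡ-< 1# (0<fromℕ-suc n)))

  fromℕ≉0 : ∀ n → .{{ℕ.NonZero n}} → fromℕ n ≉ 0#
  fromℕ≉0 (suc n) n≈0 = irrefl refl (<-respʳ-≈ n≈0 (0<fromℕ-suc n))

  fromℕ-!≉0 : ∀ n → fromℕ (n !) ≉ 0#
  fromℕ-!≉0 n = fromℕ≉0 (n !) {{n ℕ.!≢0}}

  Apart : Carrier → List Carrier → Set
  Apart h = All (h ≉_)

  ∃-strictUpperBound : (L : List Carrier) → ∃ λ h → All (_< h) L
  ∃-strictUpperBound [] = 0# , []
  ∃-strictUpperBound (b ∷ L) with ∃-strictUpperBound L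
  ... | h , L<h with compare b h
  ... | tri< b<h _ _ = h , b<h ∷ L<h
  ... | tri≈ _ b≈h _ = h + 1# , <-respˡ-≈ (sym b≈h) (x<x+1 h) ∷ All.map (λ l<h → <-trans l<h (x<x+1 h)) L<h
  ... | tri> _ _ h<b = b + 1# , x<x+1 b ∷ All.map (λ l<h → <-trans (<-trans l<h h<b) (x<x+1 b)) L<h

  fresh : (L : List Carrier) → ∃ λ h → Apart h L
  fresh L with ∃-strictUpperBound L
  ... | h , L<h = h , All.map (λ l<h h≈l → irrefl (sym h≈l) l<h) L<h

  *-cancelˡ : ∀ {x y z} → x ≉ 0# → x * y ≈ x * z → y ≈ z
  *-cancelˡ {x} {y} {z} x≉0 xy≈xz = begin
    y                 ≈⟨ *-identityˡ y ⟨
    1# * y            ≈⟨ *-congʳ x⁻¹x≈1 ⟨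
    (x ⁻¹ * x) * y    ≈⟨ *-assoc _ _ _ ⟩
    x ⁻¹ * (x * y)    ≈⟨ *-congˡ xy≈xz ⟩
    x ⁻¹ * (x * z)    ≈⟨ *-assoc _ _ _ ⟨
    (x ⁻¹ * x) * z    ≈⟨ *-congʳ x⁻¹x≈1 ⟩
    1# * z            ≈⟨ *-identityˡ z ⟩
    z                 ∎
    where
    x⁻¹x≈1 : x ⁻¹ * x ≈ 1#
    x⁻¹x≈1 = trans (*-comm _ _) (inverseʳ x x≉0)

  ⁻¹≉0 : ∀ {x} → x ≉ 0# → x ⁻¹ ≉ 0#
  ⁻¹≉0 {x} x≉0 x⁻¹≈0 = 0≉1 (trans (sym (trans (*-congˡ x⁻¹≈0) (zeroʳ x))) (inverseʳ x x≉0))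

  ⁻¹-unique : ∀ x y → x * y ≈ 1# → y ≈ x ⁻¹
  ⁻¹-unique x y x*y≈1 = begin
    y                 ≈⟨ *-identityʳ y ⟨
    y * 1#            ≈⟨ *-congˡ (inverseʳ x x≉0) ⟨
    y * (x * x ⁻¹)    ≈⟨ x∙yz≈xy∙z y x (x ⁻¹) ⟩
    (y * x) * x ⁻¹    ≈⟨ *-congʳ (trans (*-comm y x) x*y≈1) ⟩
    1# * x ⁻¹         ≈⟨ *-identityˡ _ ⟩
    x ⁻¹              ∎
    where
    x≉0 : x ≉ 0#
    x≉0 x≈0 = 0≉1 (trans (sym (trans (*-congʳ x≈0) (zeroˡ y))) x*y≈1)

  x≉y∧x*z≈y*z⇒z≈0 : ∀ {x y z} → x ≉ y → x * z ≈ y * z → z ≈ 0#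
  x≉y∧x*z≈y*z⇒z≈0 {x} {y} {z} x≉y xz≈yz = *-cancelˡ x-y≉0 (begin
    (x - y) * z      ≈⟨ distribʳ z x (- y) ⟩
    x * z + - y * z  ≈⟨ +-congˡ (-‿distribˡ-* y z) ⟨
    x * z - y * z    ≈⟨ x≈y⇒x-y≈0 xz≈yz ⟩
    0#               ≈⟨ zeroʳ (x - y) ⟨
    (x - y) * 0#     ∎)
    where
    x-y≉0 : x - y ≉ 0#
    x-y≉0 x-y≈0 = x≉y (x-y≈0⇒x≈y x y x-y≈0)

  -- Finite sums

  sumTo-cong : ∀ n {f g : ℕ → Carrier} → (∀ i → i ℕ.≤ n → f i ≈ g i) → sumTo n f ≈ sumTo n g
  sumTo-cong zero f≈g = f≈g 0 z≤n
  sumTo-cong (suc n) f≈g = +-cong (sumTo-cong n (λ i i≤n → f≈g i (ℕ.m≤n⇒m≤1+n i≤n))) (f≈g (suc n) ℕ.≤-refl)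

  sumTo-unfoldˡ : ∀ n f → sumTo (suc n) f ≈ f 0 + sumTo n (f ∘ suc)
  sumTo-unfoldˡ zero f = refl
  sumTo-unfoldˡ (suc n) f = trans (+-congʳ (sumTo-unfoldˡ n f)) (+-assoc _ _ _)

  sumTo-+ : ∀ n f g → sumTo n (λ i → f i + g i) ≈ sumTo n f + sumTo n g
  sumTo-+ zero f g = refl
  sumTo-+ (suc n) f g = trans (+-congʳ (sumTo-+ n f g)) (+-interchange _ _ _ _)

  *-sumTo : ∀ n c f → c * sumTo n f ≈ sumTo n (λ i → c * f i)
  *-sumTo zero c f = refl
  *-sumTo (suc n) c f = trans (distribˡ _ _ _) (+-congʳ (*-sumTo n c f))

  -‿sumTo : ∀ n f → - sumTo n f ≈ sumTo n (λ i → - f i)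
  -‿sumTo n f = begin
    - sumTo n f                 ≈⟨ -1*x≈-x _ ⟨
    - 1# * sumTo n f            ≈⟨ *-sumTo n (- 1#) f ⟩
    sumTo n (λ i → - 1# * f i)  ≈⟨ sumTo-cong n (λ i _ → -1*x≈-x (f i)) ⟩
    sumTo n (λ i → - f i)       ∎

  sumTo-0# : ∀ n → sumTo n (λ _ → 0#) ≈ 0#
  sumTo-0# zero = refl
  sumTo-0# (suc n) = trans (+-identityʳ _) (sumTo-0# n)

  sumTo-pad : ∀ {m} M f → m ℕ.≤ M → (∀ i → m ℕ.< i → f i ≈ 0#) → sumTo M f ≈ sumTo m f
  sumTo-pad zero f z≤n f≈0 = refl
  sumTo-pad (suc M) f m≤1+M f≈0 with ℕ.m≤n⇒m<n∨m≡n m≤1+M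
  ... | inj₂ ≡.refl = refl
  ... | inj₁ (s≤s m≤M) = trans (+-cong (sumTo-pad M f m≤M f≈0) (f≈0 (suc M) (s≤s m≤M))) (+-identityʳ _)

  -- Polynomials vanishing on an infinite set

  poly : ℕ → (ℕ → Carrier) → Carrier → Carrier
  poly M c h = sumTo M (λ i → c i * pow h i)

  horner : ℕ → (ℕ → Carrier) → Carrier → Carrier
  horner zero c h = c 0
  horner (suc n) c h = c 0 + h * horner n (c ∘ suc) h

  poly≈horner : ∀ n c h → poly n c h ≈ horner n c h
  poly≈horner zero c h = *-identityʳ _
  poly≈horner (suc n) c h = begin
    poly (suc n) c h                                      ≈⟨ sumTo-unfoldˡ n _ ⟩
    c 0 * 1# + sumTo n (λ i → c (suc i) * (h * pow h i))  ≈⟨ +-cong (*-identityʳ _) (sumTo-cong n (λ i _ → x∙yz≈y∙xz _ _ _)) ⟩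
    c 0 + sumTo n (λ i → h * (c (suc i) * pow h i))       ≈⟨ +-congˡ (*-sumTo n h _) ⟨
    c 0 + h * poly n (c ∘ suc) h                          ≈⟨ +-congˡ (*-congˡ (poly≈horner n (c ∘ suc) h)) ⟩
    c 0 + h * horner n (c ∘ suc) h                        ∎

  -- The coefficients of the quotient of horner (suc n) c h by h − a (synthetic division).
  quotient : ℕ → (ℕ → Carrier) → Carrier → ℕ → Carrier
  quotient zero c a i = c 1
  quotient (suc n) c a zero = horner (suc n) (c ∘ suc) a
  quotient (suc n) c a (suc i) = quotient n (c ∘ suc) a i

  quotient-lead : ∀ n c a → quotient n c a n ≡ c (suc n)
  quotient-lead zero c a = ≡.refl
  quotient-lead (suc n) c a = quotient-lead n (c ∘ suc) a

  -- Both sides are moved so that no subtraction occurs: it is then a semiring identity.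
  horner-division : ∀ n c a h →
    horner (suc n) c h + a * horner n (quotient n c a) h ≈ h * horner n (quotient n c a) h + horner (suc n) c a
  horner-division zero c a h =
    solve 4 (λ c₀ c₁ h a → (c₀ :+ h :* c₁) :+ a :* c₁ := h :* c₁ :+ (c₀ :+ a :* c₁)) refl (c 0) (c 1) h a
  horner-division (suc n) c a h = begin
    (c 0 + h * p) + a * (r + h * q)
      ≈⟨ solve 6 (λ c₀ h a p q r → (c₀ :+ h :* p) :+ a :* (r :+ h :* q) := (c₀ :+ a :* r) :+ h :* (p :+ a :* q))
                 refl (c 0) h a p q r ⟩
    (c 0 + a * r) + h * (p + a * q)
      ≈⟨ +-congˡ (*-congˡ (horner-division n (c ∘ suc) a h)) ⟩
    (c 0 + a * r) + h * (h * q + r)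
      ≈⟨ solve 5 (λ c₀ h a q r → (c₀ :+ a :* r) :+ h :* (h :* q :+ r) := h :* (r :+ h :* q) :+ (c₀ :+ a :* r))
                 refl (c 0) h a q r ⟩
    h * (r + h * q) + (c 0 + a * r)
      ∎
    where
    p = horner (suc n) (c ∘ suc) h
    q = horner n (quotient n (c ∘ suc) a) h
    r = horner (suc n) (c ∘ suc) a

  -- Dividing by h − a for a fresh a gives a quotient with the same leading coefficient
  -- which vanishes off one more point.
  horner-lead≈0 : ∀ n L c → (∀ h → Apart h L → horner n c h ≈ 0#) → c n ≈ 0#
  horner-lead≈0 zero L c c≈0 with fresh L
  ... | h , h#L = c≈0 h h#L
  horner-lead≈0 (suc n) L c c≈0 with fresh L
  ... | a , a#L = ≡.subst (_≈ 0#) (quotient-lead n c a) (horner-lead≈0 n (a ∷ L) (quotient n c a) q≈0)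
    where
    q≈0 : ∀ h → Apart h (a ∷ L) → horner n (quotient n c a) h ≈ 0#
    q≈0 h (h≉a ∷ h#L) = x≉y∧x*z≈y*z⇒z≈0 h≉a (begin
      h * q                       ≈⟨ +-identityʳ _ ⟨
      h * q + 0#                  ≈⟨ +-congˡ (c≈0 a a#L) ⟨
      h * q + horner (suc n) c a  ≈⟨ horner-division n c a h ⟨
      horner (suc n) c h + a * q  ≈⟨ +-congʳ (c≈0 h h#L) ⟩
      0# + a * q                  ≈⟨ +-identityˡ _ ⟩
      a * q                       ∎)
      where q = horner n (quotient n c a) h

  poly≈0⇒lead≈0 : ∀ M c → (∀ h → poly M c h ≈ 0#) → c M ≈ 0#
  poly≈0⇒lead≈0 M c p≈0 = horner-lead≈0 M [] c (λ h _ → trans (sym (poly≈horner M c h)) (p≈0 h))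

  poly≈0⇒coeff≈0 : ∀ M c → (∀ h → poly M c h ≈ 0#) → ∀ i → i ℕ.≤ M → c i ≈ 0#
  poly≈0⇒coeff≈0 M c p≈0 i i≤M with ℕ.m≤n⇒m<n∨m≡n i≤M
  ... | inj₂ ≡.refl = poly≈0⇒lead≈0 i c p≈0
  poly≈0⇒coeff≈0 (suc M) c p≈0 i _ | inj₁ (s≤s i≤M) =
    poly≈0⇒coeff≈0 M c (λ h → trans (sym (drop-lead h)) (p≈0 h)) i i≤M
    where
    drop-lead : ∀ h → poly (suc M) c h ≈ poly M c h
    drop-lead h = trans (+-congˡ (trans (*-congʳ (poly≈0⇒lead≈0 (suc M) c p≈0)) (zeroˡ _))) (+-identityʳ _)

  poly-coeff-injective : ∀ M c d → (∀ h → poly M c h ≈ poly M d h) → ∀ i → i ℕ.≤ M → c i ≈ d i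
  poly-coeff-injective M c d p≈q i i≤M =
    x-y≈0⇒x≈y (c i) (d i) (poly≈0⇒coeff≈0 M (λ i → c i - d i) p-q≈0 i i≤M)
    where
    p-q≈0 : ∀ h → poly M (λ i → c i - d i) h ≈ 0#
    p-q≈0 h = begin
      poly M (λ i → c i - d i) h
        ≈⟨ sumTo-cong M (λ i _ → trans (distribʳ _ _ _) (+-congˡ (sym (-‿distribˡ-* _ _)))) ⟩
      sumTo M (λ i → c i * pow h i + - (d i * pow h i))  ≈⟨ sumTo-+ M _ _ ⟩
      poly M c h + sumTo M (λ i → - (d i * pow h i))     ≈⟨ +-congˡ (-‿sumTo M _) ⟨
      poly M c h - poly M d h                            ≈⟨ x≈y⇒x-y≈0 (p≈q h) ⟩
      0#                                                 ∎

  -- The exponential series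

  deriv : Series → Series
  deriv f k = fromℕ (suc k) * f (suc k)

  deriv-⊛ : ∀ f g m → deriv (f ⊛ g) m ≈ (deriv f ⊛ g) m + (f ⊛ deriv g) m
  deriv-⊛ f g m = begin
    N * sumTo (suc m) (λ j → f j * g (suc m ∸ j))   ≈⟨ *-sumTo (suc m) N _ ⟩
    sumTo (suc m) (λ j → N * (f j * g (suc m ∸ j)))  ≈⟨ sumTo-cong (suc m) split ⟩
    sumTo (suc m) (λ j → Df j + Dg j)                ≈⟨ sumTo-+ (suc m) Df Dg ⟩
    sumTo (suc m) Df + sumTo (suc m) Dg              ≈⟨ +-cong Σ-Df Σ-Dg ⟩
    (deriv f ⊛ g) m + (f ⊛ deriv g) m                ∎
    where
    N = fromℕ (suc m)
    Df Dg : ℕ → Carrier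
    Df j = fromℕ j * f j * g (suc m ∸ j)
    Dg j = f j * (fromℕ (suc m ∸ j) * g (suc m ∸ j))
    split : ∀ j → j ℕ.≤ suc m → N * (f j * g (suc m ∸ j)) ≈ Df j + Dg j
    split j j≤1+m = begin
      N * (f j * g (suc m ∸ j))                              ≈⟨ *-congʳ (fromℕ-+-∸ j≤1+m) ⟩
      (fromℕ j + fromℕ (suc m ∸ j)) * (f j * g (suc m ∸ j))
        ≈⟨ solve 4 (λ x y e f → (x :+ y) :* (e :* f) := x :* e :* f :+ e :* (y :* f)) refl _ _ _ _ ⟩
      Df j + Dg j                                            ∎
    Σ-Df : sumTo (suc m) Df ≈ (deriv f ⊛ g) m
    Σ-Df = begin
      sumTo (suc m) Df                        ≈⟨ sumTo-unfoldˡ m Df ⟩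
      0# * f 0 * g (suc m) + (deriv f ⊛ g) m  ≈⟨ +-congʳ (trans (*-congʳ (zeroˡ _)) (zeroˡ _)) ⟩
      0# + (deriv f ⊛ g) m                    ≈⟨ +-identityˡ _ ⟩
      (deriv f ⊛ g) m                         ∎
    Σ-Dg : sumTo (suc m) Dg ≈ (f ⊛ deriv g) m
    Σ-Dg = begin
      sumTo m Dg + f (suc m) * (fromℕ (m ∸ m) * g (m ∸ m))
        ≈⟨ +-cong (sumTo-cong m shift) (trans (*-congˡ (trans (*-congʳ (fromℕ-n∸n m)) (zeroˡ _))) (zeroʳ _)) ⟩
      (f ⊛ deriv g) m + 0#  ≈⟨ +-identityʳ _ ⟩
      (f ⊛ deriv g) m       ∎
      where
      shift : ∀ j → j ℕ.≤ m → Dg j ≈ f j * deriv g (m ∸ j)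
      shift j j≤m rewrite ℕ.+-∸-assoc 1 j≤m = refl

  deriv-expX : ∀ y k → deriv (expX y) k ≈ y * expX y k
  deriv-expX y k = begin
    N * (y * pow y k * fromℕ (suc k !) ⁻¹)  ≈⟨ x∙yz≈y∙xz _ _ _ ⟩
    y * pow y k * (N * fromℕ (suc k !) ⁻¹)  ≈⟨ *-congˡ (⁻¹-unique K _ K*[N*[1+k]!⁻¹]≈1) ⟩
    y * pow y k * K ⁻¹                      ≈⟨ *-assoc _ _ _ ⟩
    y * expX y k                            ∎
    where
    N = fromℕ (suc k)
    K = fromℕ (k !)
    K*[N*[1+k]!⁻¹]≈1 : K * (N * fromℕ (suc k !) ⁻¹) ≈ 1#
    K*[N*[1+k]!⁻¹]≈1 = begin
      K * (N * fromℕ (suc k !) ⁻¹)          ≈⟨ x∙yz≈xy∙z K N _ ⟩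
      K * N * fromℕ (suc k !) ⁻¹            ≈⟨ *-congʳ (trans (fromℕ-* (suc k) (k !)) (*-comm N K)) ⟨
      fromℕ (suc k !) * fromℕ (suc k !) ⁻¹  ≈⟨ inverseʳ _ (fromℕ-!≉0 (suc k)) ⟩
      1#                                    ∎

  expX-0 : ∀ y → expX y 0 ≈ 1#
  expX-0 y = trans (*-identityˡ _) (sym (⁻¹-unique (fromℕ 1) 1# (trans (*-identityʳ _) (+-identityʳ 1#))))

  deriv-expX⊛expX : ∀ a b m → deriv (expX a ⊛ expX b) m ≈ (a + b) * (expX a ⊛ expX b) m
  deriv-expX⊛expX a b m = begin
    deriv (expX a ⊛ expX b) m
      ≈⟨ deriv-⊛ (expX a) (expX b) m ⟩
    (deriv (expX a) ⊛ expX b) m + (expX a ⊛ deriv (expX b)) m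
      ≈⟨ +-cong (sumTo-cong m (λ j _ → trans (*-congʳ (deriv-expX a j)) (*-assoc _ _ _)))
                (sumTo-cong m (λ j _ → trans (*-congˡ (deriv-expX b (m ∸ j))) (x∙yz≈y∙xz _ _ _))) ⟩
    sumTo m (λ j → a * (expX a j * expX b (m ∸ j))) + sumTo m (λ j → b * (expX a j * expX b (m ∸ j)))
      ≈⟨ +-cong (*-sumTo m a _) (*-sumTo m b _) ⟨
    a * (expX a ⊛ expX b) m + b * (expX a ⊛ expX b) m
      ≈⟨ distribʳ _ _ _ ⟨
    (a + b) * (expX a ⊛ expX b) m
      ∎

  binomial : ∀ a b m → pow (a + b) m ≈ fromℕ (m !) * (expX a ⊛ expX b) m
  binomial a b zero = sym (begin
    fromℕ 1 * (expX a 0 * expX b 0)  ≈⟨ *-cong (+-identityʳ 1#) (*-cong (expX-0 a) (expX-0 b)) ⟩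
    1# * (1# * 1#)                   ≈⟨ trans (*-identityˡ _) (*-identityˡ _) ⟩
    1#                               ∎)
  binomial a b (suc m) = begin
    (a + b) * pow (a + b) m          ≈⟨ *-congˡ (binomial a b m) ⟩
    (a + b) * (M * S m)              ≈⟨ x∙yz≈y∙xz _ _ _ ⟩
    M * ((a + b) * S m)              ≈⟨ *-congˡ (deriv-expX⊛expX a b m) ⟨
    M * (fromℕ (suc m) * S (suc m))  ≈⟨ x∙yz≈xy∙z _ _ _ ⟩
    M * fromℕ (suc m) * S (suc m)    ≈⟨ *-congʳ (trans (fromℕ-* (suc m) (m !)) (*-comm _ _)) ⟨
    fromℕ (suc m !) * S (suc m)      ∎
    where
    M = fromℕ (m !)
    S = expX a ⊛ expX b

  -- shiftedExp i y m = [tᵐ] (tⁱ e^{yt}).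
  shiftedExp : ℕ → Carrier → ℕ → Carrier
  shiftedExp zero y m = expX y m
  shiftedExp (suc i) y zero = 0#
  shiftedExp (suc i) y (suc m) = shiftedExp i y m

  shiftedExp-≤ : ∀ {i m} y → i ℕ.≤ m → shiftedExp i y m ≡ expX y (m ∸ i)
  shiftedExp-≤ y z≤n = ≡.refl
  shiftedExp-≤ y (s≤s i≤m) = shiftedExp-≤ y i≤m

  shiftedExp-> : ∀ {i m} y → m ℕ.< i → shiftedExp i y m ≡ 0#
  shiftedExp-> {suc i} {zero} y _ = ≡.refl
  shiftedExp-> {suc i} {suc m} y (s≤s m<i) = shiftedExp-> y m<i

  ⊛-expX-pad : ∀ f y {m} M → m ℕ.≤ M → (f ⊛ expX y) m ≈ sumTo M (λ i → f i * shiftedExp i y m)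
  ⊛-expX-pad f y {m} M m≤M = sym (begin
    sumTo M (λ i → f i * shiftedExp i y m)
      ≈⟨ sumTo-pad M _ m≤M (λ i m<i → trans (*-congˡ (reflexive (shiftedExp-> y m<i))) (zeroʳ _)) ⟩
    sumTo m (λ i → f i * shiftedExp i y m)
      ≈⟨ sumTo-cong m (λ i i≤m → *-congˡ (reflexive (shiftedExp-≤ y i≤m))) ⟩
    (f ⊛ expX y) m
      ∎)

  pow-cong : ∀ {x y} m → x ≈ y → pow x m ≈ pow y m
  pow-cong zero x≈y = refl
  pow-cong (suc m) x≈y = *-cong x≈y (pow-cong m x≈y)

  -- Linear combinations of shifted powers

  appell : Series → ℕ → Carrier → Carrier
  appell G m y = fromℕ (m !) * (G ⊛ expX y) m

  infix 5 _∙⟨_⟩^_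
  -- c ∙⟨ w ⟩^ m is the function z ↦ c · (z + w)ᵐ.
  record ShiftedPower : Set where
    constructor _∙⟨_⟩^_
    field
      coeff shift : Carrier
      degree : ℕ
  open ShiftedPower

  Combination : Set
  Combination = List ShiftedPower

  value : Carrier → ShiftedPower → Carrier
  value z (c ∙⟨ w ⟩^ m) = c * pow (z + w) m

  -- c · m!/(m − i)! · (x + w)^{m−i}, or 0 if i > m.
  derivative : ℕ → Carrier → ShiftedPower → Carrier
  derivative i x (c ∙⟨ w ⟩^ m) = c * fromℕ (m !) * shiftedExp i (x + w) m

  appellValue : Series → Carrier → ShiftedPower → Carrier
  appellValue G x (c ∙⟨ w ⟩^ m) = c * appell G m (x + w)

  maxDegree : Combination → ℕ
  maxDegree = foldr (λ p d → degree p ⊔ d) 0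

  degree≤maxDegree : ∀ ps → All (λ p → degree p ℕ.≤ maxDegree ps) ps
  degree≤maxDegree [] = []
  degree≤maxDegree (p ∷ ps) =
    ℕ.m≤m⊔n (degree p) _ ∷ All.map (ℕ.m≤n⇒m≤o⊔n (degree p)) (degree≤maxDegree ps)

  sumOver : {A : Set} → List A → (A → Carrier) → Carrier
  sumOver [] f = 0#
  sumOver (p ∷ ps) f = f p + sumOver ps f

  sumOver-cong : ∀ {A : Set} {P : A → Set} {f g : A → Carrier} ps →
    All P ps → (∀ p → P p → f p ≈ g p) → sumOver ps f ≈ sumOver ps g
  sumOver-cong [] [] f≈g = refl
  sumOver-cong (p ∷ ps) (Pp ∷ Pps) f≈g = +-cong (f≈g p Pp) (sumOver-cong ps Pps f≈g)

  sumOver-++ : ∀ {A : Set} (ps qs : List A) f → sumOver (ps ++ qs) f ≈ sumOver ps f + sumOver qs f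
  sumOver-++ [] qs f = sym (+-identityˡ _)
  sumOver-++ (p ∷ ps) qs f = trans (+-congˡ (sumOver-++ ps qs f)) (sym (+-assoc _ _ _))

  sumOver-*ˡ : ∀ {A : Set} (ps : List A) c f → sumOver ps (λ p → c * f p) ≈ c * sumOver ps f
  sumOver-*ˡ [] c f = sym (zeroʳ c)
  sumOver-*ˡ (p ∷ ps) c f = trans (+-congˡ (sumOver-*ˡ ps c f)) (sym (distribˡ _ _ _))

  sumOver-*ʳ : ∀ {A : Set} (ps : List A) c f → sumOver ps (λ p → f p * c) ≈ sumOver ps f * c
  sumOver-*ʳ [] c f = sym (zeroˡ c)
  sumOver-*ʳ (p ∷ ps) c f = trans (+-congˡ (sumOver-*ʳ ps c f)) (sym (distribʳ _ _ _))

  sumOver-sumTo : ∀ {A : Set} (ps : List A) M (F : A → ℕ → Carrier) →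
    sumOver ps (λ p → sumTo M (F p)) ≈ sumTo M (λ i → sumOver ps (λ p → F p i))
  sumOver-sumTo [] M F = sym (sumTo-0# M)
  sumOver-sumTo (p ∷ ps) M F =
    trans (+-congˡ (sumOver-sumTo ps M F)) (sym (sumTo-+ M (F p) (λ i → sumOver ps (λ q → F q i))))

  sumOver-applyUpTo : ∀ {A : Set} n (g : ℕ → A) f → sumOver (applyUpTo g (suc n)) f ≈ sumTo n (f ∘ g)
  sumOver-applyUpTo zero g f = +-identityʳ _
  sumOver-applyUpTo (suc n) g f =
    trans (+-congˡ (sumOver-applyUpTo n (g ∘ suc) f)) (sym (sumTo-unfoldˡ n (f ∘ g)))

  value-taylor : ∀ {M} x h p → degree p ℕ.≤ M →
    value (x + h) p ≈ poly M (λ i → fromℕ (i !) ⁻¹ * derivative i x p) h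
  value-taylor {M} x h (c ∙⟨ w ⟩^ m) m≤M = begin
    c * pow ((x + h) + w) m
      ≈⟨ *-congˡ (pow-cong m (solve 3 (λ x h w → (x :+ h) :+ w := h :+ (x :+ w)) refl x h w)) ⟩
    c * pow (h + (x + w)) m
      ≈⟨ *-congˡ (binomial h (x + w) m) ⟩
    c * (fromℕ (m !) * (expX h ⊛ expX (x + w)) m)
      ≈⟨ *-congˡ (*-congˡ (⊛-expX-pad (expX h) (x + w) M m≤M)) ⟩
    c * (fromℕ (m !) * sumTo M (λ i → expX h i * shiftedExp i (x + w) m))
      ≈⟨ trans (x∙yz≈xy∙z _ _ _) (*-sumTo M _ _) ⟩
    sumTo M (λ i → c * fromℕ (m !) * (expX h i * shiftedExp i (x + w) m))
      ≈⟨ sumTo-cong M (λ i _ → solve 4 (λ K p r S → K :* ((p :* r) :* S) := (r :* (K :* S)) :* p) refl _ _ _ _) ⟩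
    poly M (λ i → fromℕ (i !) ⁻¹ * derivative i x (c ∙⟨ w ⟩^ m)) h
      ∎

  appellValue-derivatives : ∀ {M} G x p → degree p ℕ.≤ M →
    appellValue G x p ≈ sumTo M (λ j → G j * derivative j x p)
  appellValue-derivatives {M} G x (c ∙⟨ w ⟩^ m) m≤M = begin
    c * (fromℕ (m !) * (G ⊛ expX (x + w)) m)
      ≈⟨ *-congˡ (*-congˡ (⊛-expX-pad G (x + w) M m≤M)) ⟩
    c * (fromℕ (m !) * sumTo M (λ j → G j * shiftedExp j (x + w) m))
      ≈⟨ trans (x∙yz≈xy∙z _ _ _) (*-sumTo M _ _) ⟩
    sumTo M (λ j → c * fromℕ (m !) * (G j * shiftedExp j (x + w) m))
      ≈⟨ sumTo-cong M (λ j _ → x∙yz≈y∙xz _ _ _) ⟩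
    sumTo M (λ j → G j * derivative j x (c ∙⟨ w ⟩^ m))
      ∎

  Σ-value-taylor : ∀ {M} x h ps → All (λ p → degree p ℕ.≤ M) ps →
    sumOver ps (value (x + h)) ≈ poly M (λ i → fromℕ (i !) ⁻¹ * sumOver ps (derivative i x)) h
  Σ-value-taylor {M} x h ps ps≤M = begin
    sumOver ps (value (x + h))
      ≈⟨ sumOver-cong ps ps≤M (value-taylor x h) ⟩
    sumOver ps (λ p → poly M (λ i → fromℕ (i !) ⁻¹ * derivative i x p) h)
      ≈⟨ sumOver-sumTo ps M _ ⟩
    sumTo M (λ i → sumOver ps (λ p → fromℕ (i !) ⁻¹ * derivative i x p * pow h i))
      ≈⟨ sumTo-cong M (λ i _ → trans (sumOver-*ʳ ps _ _) (*-congʳ (sumOver-*ˡ ps _ _))) ⟩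
    poly M (λ i → fromℕ (i !) ⁻¹ * sumOver ps (derivative i x)) h
      ∎

  Σ-appellValue-derivatives : ∀ {M} G x ps → All (λ p → degree p ℕ.≤ M) ps →
    sumOver ps (appellValue G x) ≈ sumTo M (λ j → G j * sumOver ps (derivative j x))
  Σ-appellValue-derivatives {M} G x ps ps≤M = begin
    sumOver ps (appellValue G x)                               ≈⟨ sumOver-cong ps ps≤M (appellValue-derivatives G x) ⟩
    sumOver ps (λ p → sumTo M (λ j → G j * derivative j x p))  ≈⟨ sumOver-sumTo ps M _ ⟩
    sumTo M (λ j → sumOver ps (λ p → G j * derivative j x p))  ≈⟨ sumTo-cong M (λ j _ → sumOver-*ˡ ps _ _) ⟩
    sumTo M (λ j → G j * sumOver ps (derivative j x))          ∎

  appell-transfer : ∀ G ps qs → (∀ z → sumOver ps (value z) ≈ sumOver qs (value z)) →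
    ∀ x → sumOver ps (appellValue G x) ≈ sumOver qs (appellValue G x)
  appell-transfer G ps qs same-values x = begin
    sumOver ps (appellValue G x)                       ≈⟨ Σ-appellValue-derivatives G x ps ps≤M ⟩
    sumTo M (λ j → G j * sumOver ps (derivative j x))  ≈⟨ sumTo-cong M (λ j j≤M → *-congˡ (same-derivatives j j≤M)) ⟩
    sumTo M (λ j → G j * sumOver qs (derivative j x))  ≈⟨ Σ-appellValue-derivatives G x qs qs≤M ⟨
    sumOver qs (appellValue G x)                       ∎
    where
    M = maxDegree ps ⊔ maxDegree qs
    ps≤M : All (λ p → degree p ℕ.≤ M) ps
    ps≤M = All.map (λ d≤ → ℕ.≤-trans d≤ (ℕ.m≤m⊔n _ _)) (degree≤maxDegree ps)
    qs≤M : All (λ p → degree p ℕ.≤ M) qs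
    qs≤M = All.map (λ d≤ → ℕ.≤-trans d≤ (ℕ.m≤n⊔m _ _)) (degree≤maxDegree qs)
    same-taylor : ∀ h → poly M (λ i → fromℕ (i !) ⁻¹ * sumOver ps (derivative i x)) h
                      ≈ poly M (λ i → fromℕ (i !) ⁻¹ * sumOver qs (derivative i x)) h
    same-taylor h = trans (sym (Σ-value-taylor x h ps ps≤M)) (trans (same-values (x + h)) (Σ-value-taylor x h qs qs≤M))
    same-derivatives : ∀ i → i ℕ.≤ M → sumOver ps (derivative i x) ≈ sumOver qs (derivative i x)
    same-derivatives i i≤M = *-cancelˡ (⁻¹≉0 (fromℕ-!≉0 i)) (poly-coeff-injective M _ _ same-taylor i i≤M)

  shiftedPowers : ℕ → (U u : ℕ → Carrier) → Combination
  shiftedPowers n U u = applyUpTo (λ k → U k ∙⟨ u k ⟩^ k) (suc n)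

  Σ-shiftedPowers : ∀ n U u f → sumOver (shiftedPowers n U u) f ≈ sumTo n (λ k → f (U k ∙⟨ u k ⟩^ k))
  Σ-shiftedPowers n U u = sumOver-applyUpTo n (λ k → U k ∙⟨ u k ⟩^ k)

  -- z ↦ z · Σₖ U k (z + u k)ᵏ, written as Σₖ U k ((z + u k)ᵏ⁺¹ − u k (z + u k)ᵏ).
  multipliedShiftedPowers : ℕ → (U u : ℕ → Carrier) → Combination
  multipliedShiftedPowers n U u =
    applyUpTo (λ k → U k ∙⟨ u k ⟩^ suc k) (suc n) ++ applyUpTo (λ k → - (U k * u k) ∙⟨ u k ⟩^ k) (suc n)

  Σ-multipliedShiftedPowers : ∀ n U u f →
    sumOver (multipliedShiftedPowers n U u) f ≈ sumTo n (λ k → f (U k ∙⟨ u k ⟩^ suc k) + f (- (U k * u k) ∙⟨ u k ⟩^ k))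
  Σ-multipliedShiftedPowers n U u f = begin
    sumOver (applyUpTo g (suc n) ++ applyUpTo g′ (suc n)) f
      ≈⟨ sumOver-++ (applyUpTo g (suc n)) _ f ⟩
    sumOver (applyUpTo g (suc n)) f + sumOver (applyUpTo g′ (suc n)) f
      ≈⟨ +-cong (sumOver-applyUpTo n g f) (sumOver-applyUpTo n g′ f) ⟩
    sumTo n (f ∘ g) + sumTo n (f ∘ g′)
      ≈⟨ sumTo-+ n (f ∘ g) (f ∘ g′) ⟨
    sumTo n (λ k → f (g k) + f (g′ k))
      ∎
    where
    g g′ : ℕ → ShiftedPower
    g k = U k ∙⟨ u k ⟩^ suc k
    g′ k = - (U k * u k) ∙⟨ u k ⟩^ k

  Σ-value-multipliedShiftedPowers : ∀ n U u z →
    sumOver (multipliedShiftedPowers n U u) (value z) ≈ z * sumTo n (λ k → U k * pow (z + u k) k)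
  Σ-value-multipliedShiftedPowers n U u z = begin
    sumOver (multipliedShiftedPowers n U u) (value z)
      ≈⟨ Σ-multipliedShiftedPowers n U u (value z) ⟩
    sumTo n (λ k → U k * pow (z + u k) (suc k) + - (U k * u k) * pow (z + u k) k)
      ≈⟨ sumTo-cong n (λ k _ → term (U k) (u k) (pow (z + u k) k)) ⟩
    sumTo n (λ k → z * (U k * pow (z + u k) k))
      ≈⟨ *-sumTo n z _ ⟨
    z * sumTo n (λ k → U k * pow (z + u k) k)
      ∎
    where
    term : ∀ c w p → c * ((z + w) * p) + - (c * w) * p ≈ z * (c * p)
    term c w p = begin
      c * ((z + w) * p) + - (c * w) * p
        ≈⟨ +-cong (solve 4 (λ c z w p → c :* ((z :+ w) :* p) := z :* (c :* p) :+ c :* w :* p) refl c z w p)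
                  (sym (-‿distribˡ-* _ _)) ⟩
      z * (c * p) + c * w * p - c * w * p
        ≈⟨ x+y-y≈x (c * w * p) (z * (c * p)) ⟩
      z * (c * p)
        ∎

  Σ-appellValue-multipliedShiftedPowers : ∀ G n U u x →
    sumOver (multipliedShiftedPowers n U u) (appellValue G x)
      ≈ sumTo n (λ k → U k * (appell G (suc k) (x + u k) - u k * appell G k (x + u k)))
  Σ-appellValue-multipliedShiftedPowers G n U u x =
    trans (Σ-multipliedShiftedPowers n U u (appellValue G x)) (sumTo-cong n (λ k _ → term (U k) (u k) _ _))
    where
    term : ∀ c w a b → c * a + - (c * w) * b ≈ c * (a - w * b)
    term c w a b = begin
      c * a + - (c * w) * b    ≈⟨ +-congˡ (trans (sym (-‿distribˡ-* _ _)) (-‿cong (*-assoc c w b))) ⟩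
      c * a + - (c * (w * b))  ≈⟨ +-congˡ (-‿distribʳ-* c (w * b)) ⟩
      c * a + c * - (w * b)    ≈⟨ distribˡ c a _ ⟨
      c * (a - w * b)          ∎

  shiftedPowers-appell : ∀ G n U u V v →
    (∀ z → sumTo n (λ k → U k * pow (z + u k) k) ≈ sumTo n (λ k → V k * pow (z + v k) k)) → ∀ x →
    sumTo n (λ k → U k * appell G k (x + u k)) ≈ sumTo n (λ k → V k * appell G k (x + v k))
  shiftedPowers-appell G n U u V v same x = begin
    sumTo n (λ k → U k * appell G k (x + u k))
      ≈⟨ Σ-shiftedPowers n U u _ ⟨
    sumOver (shiftedPowers n U u) (appellValue G x)
      ≈⟨ appell-transfer G (shiftedPowers n U u) (shiftedPowers n V v) same-values x ⟩
    sumOver (shiftedPowers n V v) (appellValue G x)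
      ≈⟨ Σ-shiftedPowers n V v _ ⟩
    sumTo n (λ k → V k * appell G k (x + v k))
      ∎
    where
    same-values : ∀ z → sumOver (shiftedPowers n U u) (value z) ≈ sumOver (shiftedPowers n V v) (value z)
    same-values z = trans (Σ-shiftedPowers n U u _) (trans (same z) (sym (Σ-shiftedPowers n V v _)))

  multipliedShiftedPowers-appell : ∀ G n U u V v →
    (∀ z → sumTo n (λ k → U k * pow (z + u k) k) ≈ sumTo n (λ k → V k * pow (z + v k) k)) → ∀ x →
    sumTo n (λ k → U k * (appell G (suc k) (x + u k) - u k * appell G k (x + u k)))
      ≈ sumTo n (λ k → V k * (appell G (suc k) (x + v k) - v k * appell G k (x + v k)))
  multipliedShiftedPowers-appell G n U u V v same x = begin
    _ ≈⟨ Σ-appellValue-multipliedShiftedPowers G n U u x ⟨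
    sumOver (multipliedShiftedPowers n U u) (appellValue G x)
      ≈⟨ appell-transfer G (multipliedShiftedPowers n U u) (multipliedShiftedPowers n V v) same-values x ⟩
    sumOver (multipliedShiftedPowers n V v) (appellValue G x)
      ≈⟨ Σ-appellValue-multipliedShiftedPowers G n V v x ⟩
    _ ∎
    where
    same-values : ∀ z → sumOver (multipliedShiftedPowers n U u) (value z)
                      ≈ sumOver (multipliedShiftedPowers n V v) (value z)
    same-values z = begin
      sumOver (multipliedShiftedPowers n U u) (value z)  ≈⟨ Σ-value-multipliedShiftedPowers n U u z ⟩
      z * sumTo n (λ k → U k * pow (z + u k) k)          ≈⟨ *-congˡ (same z) ⟩
      z * sumTo n (λ k → V k * pow (z + v k) k)          ≈⟨ Σ-value-multipliedShiftedPowers n V v z ⟨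
      sumOver (multipliedShiftedPowers n V v) (value z)  ∎

proposition10 : (ℝ : RealField) → let open RF ℝ in
    (a : ℕ → Carrier) → a 0 ≈ 1# →
    (n : ℕ) (u v U V : ℕ → Carrier) →
    (∀ x → sumTo n (λ k → U k * pow (x + u k) k) ≈ sumTo n (λ k → V k * pow (x + v k) k)) →
    ∀ α x →
      (sumTo n (λ k → U k * fpoly a α k (x + u k))
        ≈ sumTo n (λ k → V k * fpoly a α k (x + v k)))
      × (sumTo n (λ k → U k * (fpoly a α (suc k) (x + u k) - u k * fpoly a α k (x + u k)))
        ≈ sumTo n (λ k → V k * (fpoly a α (suc k) (x + v k) - v k * fpoly a α k (x + v k))))
proposition10 ℝ a _ n u v U V same α x =
    shiftedPowers-appell G n U u V v same x
  , multipliedShiftedPowers-appell G n U u V v same x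
  where
  open Appell ℝ
  G : RF.Series ℝ
  G = RF.powαS ℝ (RF.Fser ℝ a) α
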